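{- There is an intuitionistic ($\mathsf{NJp}$) derivation of the sequent $\Gamma\land\gamma\Rightarrow P((s_a,B),1,\ell)\lor P((s_r,B),1,\ell)$ whose size is bounded by a polynomial in $n$.
   Context: $M$ is a deterministic one-tape Turing machine with input alphabet $\Sigma$, tape alphabet $\Lambda\supseteq\Sigma\cup\{B\}$ ($B$ blank), state set $Q$, initial state $s_0$, accepting state $s_a$ and rejecting state $s_r$, which on inputs of length $n$ runs at most $\ell=p(n)$ steps ($p$ a fixed polynomial), eventually reaches $s_a$ or $s_r$ and then remains in that state forever scanning a blank at its starting position (position $1$), and never moves left of its starting position. Positions $0,\dots,\ell+1$ of the tape are considered, positions $0$ and $\ell+1$ always blank. $f:(\Lambda\cup(Q\times\Lambda))^3\to\Lambda\cup(Q\times\Lambda)$ describes the transition: if positions $i-1,i,i+1$ at step $t$ carry $a,b,c$ (elements of $\Lambda$, or of $Q\times\Lambda$ at the head position), position $i$ at step $t+1$ carries $f(a,b,c)$. Atoms $P(a,i,t)$ for $a\in\Lambda\cup(Q\times\Lambda)$, $i\le\ell+1$, $t\le\ell$. $\oplus_{j<m}p_j:\equiv\bigvee_{j<m}[p_j\land\bigwedge_{j'\ne j}\lnot p_{j'}]$ (exclusive or), $\lnot\alpha\equiv\alpha\supset\bot$. Define $\beta\equiv\bigwedge_{t\le\ell}(P(B,0,t)\land P(B,\ell+1,t))$; $\delta_0\equiv\oplus_{a_1\in\Sigma}P((s_0,a_1),1,0)\land\bigwedge_{1<i\le n}\oplus_{a\in\Sigma}P(a,i,0)\land\bigwedge_{n<i\le\ell}P(B,i,0)$;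 for $0\le t<\ell$, $\delta_{t+1}\equiv\bigwedge_{1\le i\le\ell}\bigwedge_{a,b,c}[P(a,i-1,t)\land P(b,i,t)\land P(c,i+1,t)\supset P(f(a,b,c),i,t+1)]$; $\Gamma\equiv\beta\land\bigwedge_{0\le t\le\ell}\delta_t$; $\gamma\equiv\bigwedge_{a\ne(s_a,B),(s_r,B)}\lnot P(a,1,\ell)$. -}

module Defs where

open import Data.Nat using (ℕ; zero; suc; _+_; _*_; _∸_; _^_; _≤_; _≡ᵇ_)
open import Data.Fin using (Fin) renaming (_≟_ to _≟F_)
open import Data.List using (List; []; _∷_; map; _++_; upTo; allFin; length; cartesianProduct; filterᵇ; lookup)
open import Data.List.Membership.Propositional using (_∈_)
open import Data.Product using (_×_; _,_; proj₁; proj₂; Σ)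
open import Data.Sum using (_⊎_; inj₁; inj₂)
import Data.Sum.Properties as SumP
import Data.Product.Properties as ProdP
open import Data.Bool using (Bool; true; false; if_then_else_; not; _∨_)
open import Relation.Nullary using (¬_; does)
open import Relation.Binary.PropositionalEquality using (_≡_; _≢_)
open import Function.Definitions using (Injective)

-- Polynomials with natural coefficients (coefficient list, constant first)

Poly : Set
Poly = List ℕ

eval : Poly → ℕ → ℕ
eval []       x = 0
eval (c ∷ cs) x = c + x * eval cs x

infixr 6 _∧'_
infixr 5 _∨'_
infixr 4 _⊃_

data Form (At : Set) : Set where
  atom : At → Form At
  ⊥'   : Form At
  _∧'_ : Form At → Form At → Form At
  _∨'_ : Form At → Form At → Form At
  _⊃_  : Form At → Form At → Form At

module _ {At : Set} where

  ¬' : Form At → Form At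
  ¬' α = α ⊃ ⊥'

  ⊤' : Form At
  ⊤' = ⊥' ⊃ ⊥'

  ⋀ : List (Form At) → Form At
  ⋀ []           = ⊤'
  ⋀ (p ∷ [])     = p
  ⋀ (p ∷ q ∷ ps) = p ∧' ⋀ (q ∷ ps)

  ⋁ : List (Form At) → Form At
  ⋁ []           = ⊥'
  ⋁ (p ∷ [])     = p
  ⋁ (p ∷ q ∷ ps) = p ∨' ⋁ (q ∷ ps)

  picks : List (Form At) → List (Form At × List (Form At))
  picks []       = []
  picks (p ∷ ps) = (p , ps) ∷ map (λ { (q , rs) → (q , p ∷ rs) }) (picks ps)

  -- exclusive or:  ⊕_j p_j := ⋁_j [ p_j ∧ ⋀_{j' ≠ j} ¬ p_j' ]
  ⊕ : List (Form At) → Form At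
  ⊕ ps = ⋁ (map (λ { (p , rs) → p ∧' ⋀ (map ¬' rs) }) (picks ps))

  fsize : Form At → ℕ
  fsize (atom _) = 1
  fsize ⊥'       = 1
  fsize (α ∧' β) = suc (fsize α + fsize β)
  fsize (α ∨' β) = suc (fsize α + fsize β)
  fsize (α ⊃ β)  = suc (fsize α + fsize β)

  infix 2 _⊢_
  data _⊢_ (Δ : List (Form At)) : Form At → Set where
    hyp  : ∀ {A} → A ∈ Δ → Δ ⊢ A
    ⊥E   : ∀ {A} → Δ ⊢ ⊥' → Δ ⊢ A
    ∧I   : ∀ {A B} → Δ ⊢ A → Δ ⊢ B → Δ ⊢ A ∧' B
    ∧E₁  : ∀ {A B} → Δ ⊢ A ∧' B → Δ ⊢ A
    ∧E₂  : ∀ {A B} → Δ ⊢ A ∧' B → Δ ⊢ B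
    ∨I₁  : ∀ {A B} → Δ ⊢ A → Δ ⊢ A ∨' B
    ∨I₂  : ∀ {A B} → Δ ⊢ B → Δ ⊢ A ∨' B
    ∨E   : ∀ {A B C} → Δ ⊢ A ∨' B → (A ∷ Δ) ⊢ C → (B ∷ Δ) ⊢ C → Δ ⊢ C
    ⊃I   : ∀ {A B} → (A ∷ Δ) ⊢ B → Δ ⊢ A ⊃ B
    ⊃E   : ∀ {A B} → Δ ⊢ A ⊃ B → Δ ⊢ A → Δ ⊢ B

  -- size of a derivation: number of symbols of the derivation tree,
  -- i.e. for every inference node, 1 plus the size of the formula it concludes
  dsize : ∀ {Δ A} → Δ ⊢ A → ℕ
  dsize {A = A} (hyp _)     = suc (fsize A)
  dsize {A = A} (⊥E d)      = suc (fsize A + dsize d)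
  dsize {A = A} (∧I d e)    = suc (fsize A + dsize d + dsize e)
  dsize {A = A} (∧E₁ d)     = suc (fsize A + dsize d)
  dsize {A = A} (∧E₂ d)     = suc (fsize A + dsize d)
  dsize {A = A} (∨I₁ d)     = suc (fsize A + dsize d)
  dsize {A = A} (∨I₂ d)     = suc (fsize A + dsize d)
  dsize {A = A} (∨E d e f)  = suc (fsize A + dsize d + dsize e + dsize f)
  dsize {A = A} (⊃I d)      = suc (fsize A + dsize d)
  dsize {A = A} (⊃E d e)    = suc (fsize A + dsize d + dsize e)

data Dir : Set where
  L S R : Dir

record TM : Set where
  field
    nΣ nΛ nQ : ℕ
    ι        : Fin nΣ → Fin nΛ
    ι-inj    : Injective _≡_ _≡_ ι
    B        : Fin nΛ
    B∉Σ      : ∀ a → ι a ≢ B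
    s₀ sₐ sᵣ : Fin nQ
    sₐ≢sᵣ    : sₐ ≢ sᵣ
    δ        : Fin nQ → Fin nΛ → Fin nQ × Fin nΛ × Dir

module Machine (M : TM) where
  open TM M

  Λ Q : Set
  Λ = Fin nΛ
  Q = Fin nQ

  Sym : Set
  Sym = Λ ⊎ (Q × Λ)

  allSym : List Sym
  allSym = map inj₁ (allFin nΛ) ++ map inj₂ (cartesianProduct (allFin nQ) (allFin nΛ))

  _≟S_ : (a b : Sym) → _
  _≟S_ = SumP.≡-dec _≟F_ (ProdP.≡-dec _≟F_ _≟F_)

  -- configurations: state, head position (starting position is 1), tape
  record Config : Set where
    constructor conf
    field
      state : Q
      head  : ℕ
      tape  : ℕ → Λ
  open Config public

  move : Dir → ℕ → ℕ
  move L h = h ∸ 1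
  move S h = h
  move R h = suc h

  step : Config → Config
  step (conf q h τ) with δ q (τ h)
  ... | (q' , y , d) = conf q' (move d h) (λ i → if i ≡ᵇ h then y else τ i)

  -- initial configuration on input w = w₁ … wₙ (written on positions 1..n)
  initTape : List (Fin nΣ) → ℕ → Λ
  initTape []       i       = B
  initTape (a ∷ w)  zero    = B
  initTape (a ∷ w)  (suc zero) = ι a
  initTape (a ∷ w)  (suc (suc i)) = initTape w (suc i)

  init : List (Fin nΣ) → Config
  init w = conf s₀ 1 (initTape w)

  run : List (Fin nΣ) → ℕ → Config
  run w zero    = init w
  run w (suc t) = step (run w t)

  cell : Config → ℕ → Sym
  cell c i = if i ≡ᵇ head c then inj₂ (state c , tape c i) else inj₁ (tape c i)

  NeverLeft : Set
  NeverLeft = ∀ w t → 1 ≤ head (run w t)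

  HaltsWithin : Poly → Set
  HaltsWithin p = ∀ w t → eval p (length w) ≤ t →
    (state (run w t) ≡ sₐ ⊎ state (run w t) ≡ sᵣ) × head (run w t) ≡ 1 × tape (run w t) 1 ≡ B

  Describes : (Sym → Sym → Sym → Sym) → Set
  Describes f = ∀ w t i → 1 ≤ i →
    cell (run w (suc t)) i ≡ f (cell (run w t) (i ∸ 1)) (cell (run w t) i) (cell (run w t) (suc i))

  Atom : Set
  Atom = Sym × ℕ × ℕ

  Fm : Set
  Fm = Form Atom

  P : Sym → ℕ → ℕ → Fm
  P a i t = atom (a , i , t)

  -- [a .. b] (empty if b < a)
  range : ℕ → ℕ → List ℕ
  range a b = map (a +_) (upTo (suc b ∸ a))

  module Encoding (f : Sym → Sym → Sym → Sym) (n ℓ : ℕ) where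

    β : Fm
    β = ⋀ (map (λ t → P (inj₁ B) 0 t ∧' P (inj₁ B) (suc ℓ) t) (range 0 ℓ))

    δ₀ : Fm
    δ₀ = ⊕ (map (λ a₁ → P (inj₂ (s₀ , ι a₁)) 1 0) (allFin nΣ))
      ∧' ⋀ (map (λ i → ⊕ (map (λ a → P (inj₁ (ι a)) i 0) (allFin nΣ))) (range 2 n))
      ∧' ⋀ (map (λ i → P (inj₁ B) i 0) (range (suc n) ℓ))

    triples : List (Sym × Sym × Sym)
    triples = cartesianProduct allSym (cartesianProduct allSym allSym)

    δ' : ℕ → Fm
    δ' zero    = δ₀
    δ' (suc t) = ⋀ (map (λ i → ⋀ (map (λ { (a , b , c) →
                    P a (i ∸ 1) t ∧' P b i t ∧' P c (suc i) t ⊃ P (f a b c) i (suc t) })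
                    triples)) (range 1 ℓ))

    Γ : Fm
    Γ = β ∧' ⋀ (map δ' (range 0 ℓ))

    isFinal : Sym → Bool
    isFinal a = does (a ≟S inj₂ (sₐ , B)) ∨ does (a ≟S inj₂ (sᵣ , B))

    γ : Fm
    γ = ⋀ (map (λ a → ¬' (P a 1 ℓ)) (filterᵇ (λ a → not (isFinal a)) allSym))

    goal : Fm
    goal = P (inj₂ (sₐ , B)) 1 ℓ ∨' P (inj₂ (sᵣ , B)) 1 ℓ

    Sequent : Set
    Sequent = (Γ ∧' γ ∷ []) ⊢ goal

module Submission where

-- The derivation is purely propositional: it never uses what M computes, only the
-- shape of Γ.  Write Cell i t for "cell i carries some symbol at time t" (the
-- disjunction of all P(a,i,t)) and Tape t for the conjunction of Cell i t, i ≤ ℓ+1.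
-- Tape 0 follows from δ₀ and β; Tape (t+1) follows from Tape t by splitting on the
-- three cells feeding each cell and applying the matching axiom of δ_{t+1}; the
-- derivation of Tape (t+1) is joined to that of Tape t by a cut, so the chain grows
-- linearly in t.  Finally, splitting on Cell 1 ℓ, every non-final symbol is refuted by γ.
--
-- Sizes are tracked by "sized derivations" carrying dsize ≤ (F+1)·N, where N bounds
-- the number of nodes and F the size of every formula.  All bounds are polynomial
-- expressions in n and ℓ (SizeExpr), and any such expression is polynomially bounded
-- in n once ℓ = p(n).

open import Defs
open import Data.Nat
open import Data.Nat.Properties
open import Data.Nat.Tactic.RingSolver using (solve-∀)
open import Data.Bool using (T; not)
open import Data.Unit using (tt)
open import Data.Fin using (Fin)
open import Data.Product using (_×_; _,_; Σ; ∃-syntax; map₂)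
open import Data.Sum using (inj₁; inj₂)
open import Data.List using (List; []; _∷_; map; length; upTo; allFin; cartesianProduct; filterᵇ)
open import Data.List.Properties using (length-map; length-upTo; length-tabulate; length-filter)
open import Data.List.Membership.Propositional using (_∈_)
open import Data.List.Membership.Propositional.Properties
  using (∈-map⁺; ∈-map⁻; ∈-++⁺ˡ; ∈-++⁺ʳ; ∈-allFin; ∈-cartesianProduct⁺; ∈-upTo⁺; ∈-upTo⁻; ∈-filter⁺)
open import Data.List.Relation.Binary.Subset.Propositional using (_⊆_)
open import Data.List.Relation.Unary.Any using (here; there)
open import Relation.Binary.PropositionalEquality
open import Relation.Nullary using (yes; no)
open import Relation.Nullary.Decidable using (dec-false; T?)
open import Function using (id; _∘_)

PolyBounded : (ℕ → ℕ) → Set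
PolyBounded g = ∃[ c ] ∃[ d ] (∀ n → g n ≤ c * suc n ^ d)

^-mono-exponent : ∀ n d e → suc n ^ d ≤ suc n ^ (d + e)
^-mono-exponent n d e = ^-monoʳ-≤ (suc n) (m≤m+n d e)

const-bounded : ∀ k → PolyBounded (λ _ → k)
const-bounded k = k , 0 , λ n → ≤-reflexive (sym (*-identityʳ k))

id-bounded : PolyBounded (λ n → n)
id-bounded = 1 , 1 , λ n → ≤-trans (n≤1+n n) (≤-reflexive (sym (trans (*-identityˡ _) (*-identityʳ _))))

+-bounded : ∀ {g h} → PolyBounded g → PolyBounded h → PolyBounded (λ n → g n + h n)
+-bounded (c₁ , d₁ , g≤) (c₂ , d₂ , h≤) = c₁ + c₂ , d₁ + d₂ , λ n → begin
    _ ≤⟨ +-mono-≤ (g≤ n) (h≤ n) ⟩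
    c₁ * suc n ^ d₁ + c₂ * suc n ^ d₂
      ≤⟨ +-mono-≤ (*-monoʳ-≤ c₁ (^-mono-exponent n d₁ d₂))
                  (*-monoʳ-≤ c₂ (subst (suc n ^ d₂ ≤_) (cong (suc n ^_) (+-comm d₂ d₁)) (^-mono-exponent n d₂ d₁))) ⟩
    c₁ * suc n ^ (d₁ + d₂) + c₂ * suc n ^ (d₁ + d₂)
      ≡⟨ sym (*-distribʳ-+ (suc n ^ (d₁ + d₂)) c₁ c₂) ⟩
    (c₁ + c₂) * suc n ^ (d₁ + d₂) ∎
  where open ≤-Reasoning

*-bounded : ∀ {g h} → PolyBounded g → PolyBounded h → PolyBounded (λ n → g n * h n)
*-bounded (c₁ , d₁ , g≤) (c₂ , d₂ , h≤) = c₁ * c₂ , d₁ + d₂ , λ n → begin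
    _ ≤⟨ *-mono-≤ (g≤ n) (h≤ n) ⟩
    c₁ * suc n ^ d₁ * (c₂ * suc n ^ d₂) ≡⟨ regroup c₁ c₂ (suc n ^ d₁) (suc n ^ d₂) ⟩
    c₁ * c₂ * (suc n ^ d₁ * suc n ^ d₂) ≡⟨ cong (c₁ * c₂ *_) (sym (^-distribˡ-+-* (suc n) d₁ d₂)) ⟩
    c₁ * c₂ * suc n ^ (d₁ + d₂) ∎
  where
    open ≤-Reasoning
    regroup : ∀ a b x y → a * x * (b * y) ≡ a * b * (x * y)
    regroup = solve-∀

eval-bounded : ∀ p → PolyBounded (eval p)
eval-bounded []       = const-bounded 0
eval-bounded (c ∷ cs) = +-bounded (const-bounded c) (*-bounded id-bounded (eval-bounded cs))

-- (m+2)^d ≤ 2^d·(m+1)^d, since m + 2 ≤ 2·(m+1).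
suc-suc-^-≤ : ∀ m d → suc (suc m) ^ d ≤ 2 ^ d * suc m ^ d
suc-suc-^-≤ m zero    = ≤-refl
suc-suc-^-≤ m (suc d) = begin
    suc (suc m) * suc (suc m) ^ d ≤⟨ *-mono-≤ (s≤s (m≤n+m (suc m) m)) (suc-suc-^-≤ m d) ⟩
    (suc m + suc m) * (2 ^ d * suc m ^ d) ≡⟨ regroup (suc m) (2 ^ d) (suc m ^ d) ⟩
    2 * 2 ^ d * (suc m * suc m ^ d) ∎
  where
    open ≤-Reasoning
    regroup : ∀ s x y → (s + s) * (x * y) ≡ 2 * x * (s * y)
    regroup = solve-∀

-- The shape of bound demanded by the theorem: c·(n+1)^d ≤ c'·n^d + c' with c' = c·2^d.
standard-form : ∀ {g} → PolyBounded g → ∃[ c ] ∃[ d ] (∀ n → g n ≤ c * n ^ d + c)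
standard-form {g} (c , d , g≤) = c * 2 ^ d , d , bound
  where
    c≤c' : c ≤ c * 2 ^ d
    c≤c' = m≤m*n c (2 ^ d) {{m^n≢0 2 d}}
    bound : ∀ n → g n ≤ c * 2 ^ d * n ^ d + c * 2 ^ d
    bound zero = begin
      g 0                         ≤⟨ g≤ 0 ⟩
      c * 1 ^ d                   ≡⟨ cong (c *_) (^-zeroˡ d) ⟩
      c * 1                       ≡⟨ *-identityʳ c ⟩
      c                           ≤⟨ c≤c' ⟩
      c * 2 ^ d                   ≤⟨ m≤n+m _ _ ⟩
      c * 2 ^ d * 0 ^ d + c * 2 ^ d ∎
      where open ≤-Reasoning
    bound (suc m) = begin
      g (suc m)                         ≤⟨ g≤ (suc m) ⟩
      c * suc (suc m) ^ d               ≤⟨ *-monoʳ-≤ c (suc-suc-^-≤ m d) ⟩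
      c * (2 ^ d * suc m ^ d)           ≡⟨ sym (*-assoc c (2 ^ d) (suc m ^ d)) ⟩
      c * 2 ^ d * suc m ^ d             ≤⟨ m≤m+n _ _ ⟩
      c * 2 ^ d * suc m ^ d + c * 2 ^ d ∎
      where open ≤-Reasoning

infixl 6 _+ₑ_
infixl 7 _*ₑ_

data SizeExpr : Set where
  lit       : ℕ → SizeExpr
  n̂ ℓ̂       : SizeExpr
  1+ₑ_      : SizeExpr → SizeExpr
  _+ₑ_ _*ₑ_ : SizeExpr → SizeExpr → SizeExpr

⟦_⟧ : SizeExpr → ℕ → ℕ → ℕ
⟦ lit k ⟧    n ℓ = k
⟦ n̂ ⟧        n ℓ = n
⟦ ℓ̂ ⟧        n ℓ = ℓ
⟦ 1+ₑ e ⟧    n ℓ = suc (⟦ e ⟧ n ℓ)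
⟦ e₁ +ₑ e₂ ⟧ n ℓ = ⟦ e₁ ⟧ n ℓ + ⟦ e₂ ⟧ n ℓ
⟦ e₁ *ₑ e₂ ⟧ n ℓ = ⟦ e₁ ⟧ n ℓ * ⟦ e₂ ⟧ n ℓ

⟦⟧-bounded : ∀ p e → PolyBounded (λ n → ⟦ e ⟧ n (eval p n))
⟦⟧-bounded p (lit k)    = const-bounded k
⟦⟧-bounded p n̂          = id-bounded
⟦⟧-bounded p ℓ̂          = eval-bounded p
⟦⟧-bounded p (1+ₑ e)    = +-bounded (const-bounded 1) (⟦⟧-bounded p e)
⟦⟧-bounded p (e₁ +ₑ e₂) = +-bounded (⟦⟧-bounded p e₁) (⟦⟧-bounded p e₂)
⟦⟧-bounded p (e₁ *ₑ e₂) = *-bounded (⟦⟧-bounded p e₁) (⟦⟧-bounded p e₂)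

left≤ : ∀ a b → a ≤ suc (a + b)
left≤ a b = ≤-trans (m≤m+n a b) (n≤1+n _)

right≤ : ∀ a b → b ≤ suc (a + b)
right≤ a b = ≤-trans (m≤n+m b a) (n≤1+n _)

one-premise : ∀ {F a b N} → a ≤ F → b ≤ suc F * N → suc (a + b) ≤ suc F * suc N
one-premise {F} {a} {b} {N} a≤ b≤ =
  subst (suc (a + b) ≤_) (sym (*-suc (suc F) N)) (+-mono-≤ (s≤s a≤) b≤)

two-premises : ∀ {F a b c N₁ N₂} → a ≤ F → b ≤ suc F * N₁ → c ≤ suc F * N₂ →
               suc (a + b + c) ≤ suc F * suc (N₁ + N₂)
two-premises {F} {a} {b} {c} {N₁} {N₂} a≤ b≤ c≤ =
  subst (suc (a + b + c) ≤_) (nodes F N₁ N₂) (+-mono-≤ (+-mono-≤ (s≤s a≤) b≤) c≤)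
  where
    nodes : ∀ F N₁ N₂ → suc F + suc F * N₁ + suc F * N₂ ≡ suc F * suc (N₁ + N₂)
    nodes = solve-∀

three-premises : ∀ {F a b c d N₁ N₂ N₃} → a ≤ F → b ≤ suc F * N₁ → c ≤ suc F * N₂ →
                 d ≤ suc F * N₃ → suc (a + b + c + d) ≤ suc F * suc (N₁ + N₂ + N₃)
three-premises {F} {a} {b} {c} {d} {N₁} {N₂} {N₃} a≤ b≤ c≤ d≤ =
  subst (suc (a + b + c + d) ≤_) (nodes F N₁ N₂ N₃)
        (+-mono-≤ (+-mono-≤ (+-mono-≤ (s≤s a≤) b≤) c≤) d≤)
  where
    nodes : ∀ F N₁ N₂ N₃ → suc F + suc F * N₁ + suc F * N₂ + suc F * N₃ ≡ suc F * suc (N₁ + N₂ + N₃)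
    nodes = solve-∀

-- Induction step and base of the bound  k·(m+1) + c  on the size of k components of
-- size ≤ m joined by binary connectives (c ≥ 1 covers the case k = 0).
join-step : ∀ m k c → suc (m + (k * suc m + c)) ≡ suc k * suc m + c
join-step = solve-∀

single≤ : ∀ m c → m ≤ 1 * suc m + c
single≤ m c = ≤-trans (n≤1+n m) (≤-trans (≤-reflexive (sym (*-identityˡ (suc m)))) (m≤m+n _ c))

module _ {At : Set} where

  -- Read N as a bound
  -- on the number of inference nodes and F as a bound on the size of every formula
  -- concluded at a node: each node then contributes at most F + 1 to dsize.
  record Sized (F : ℕ) (Δ : List (Form At)) (A : Form At) (N : ℕ) : Set where
    constructor sized
    field
      derivation : Δ ⊢ A
      size-bound : dsize derivation ≤ suc F * N
  open Sized public

  module _ {F : ℕ} {Δ : List (Form At)} where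

    weaken : ∀ {A N N'} → N ≤ N' → Sized F Δ A N → Sized F Δ A N'
    weaken N≤N' (sized d s) = sized d (≤-trans s (*-monoʳ-≤ (suc F) N≤N'))

    hypˢ : ∀ {A} → fsize A ≤ F → A ∈ Δ → Sized F Δ A 1
    hypˢ {A} A≤F A∈Δ = sized (hyp A∈Δ) (subst (suc (fsize A) ≤_) (sym (*-identityʳ (suc F))) (s≤s A≤F))

    ⊥Eˢ : ∀ {A N} → fsize A ≤ F → Sized F Δ ⊥' N → Sized F Δ A (suc N)
    ⊥Eˢ A≤F (sized d s) = sized (⊥E d) (one-premise A≤F s)

    ∧Iˢ : ∀ {A B N₁ N₂} → fsize (A ∧' B) ≤ F → Sized F Δ A N₁ → Sized F Δ B N₂ →
          Sized F Δ (A ∧' B) (suc (N₁ + N₂))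
    ∧Iˢ C≤F (sized d s) (sized e t) = sized (∧I d e) (two-premises C≤F s t)

    ∧E₁ˢ : ∀ {A B N} → fsize A ≤ F → Sized F Δ (A ∧' B) N → Sized F Δ A (suc N)
    ∧E₁ˢ A≤F (sized d s) = sized (∧E₁ d) (one-premise A≤F s)

    ∧E₂ˢ : ∀ {A B N} → fsize B ≤ F → Sized F Δ (A ∧' B) N → Sized F Δ B (suc N)
    ∧E₂ˢ B≤F (sized d s) = sized (∧E₂ d) (one-premise B≤F s)

    ∨I₁ˢ : ∀ {A B N} → fsize (A ∨' B) ≤ F → Sized F Δ A N → Sized F Δ (A ∨' B) (suc N)
    ∨I₁ˢ C≤F (sized d s) = sized (∨I₁ d) (one-premise C≤F s)

    ∨I₂ˢ : ∀ {A B N} → fsize (A ∨' B) ≤ F → Sized F Δ B N → Sized F Δ (A ∨' B) (suc N)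
    ∨I₂ˢ C≤F (sized d s) = sized (∨I₂ d) (one-premise C≤F s)

    ∨Eˢ : ∀ {A B C N₁ N₂ N₃} → fsize C ≤ F → Sized F Δ (A ∨' B) N₁ →
          Sized F (A ∷ Δ) C N₂ → Sized F (B ∷ Δ) C N₃ → Sized F Δ C (suc (N₁ + N₂ + N₃))
    ∨Eˢ C≤F (sized d s) (sized e t) (sized g u) = sized (∨E d e g) (three-premises C≤F s t u)

    ⊃Iˢ : ∀ {A B N} → fsize (A ⊃ B) ≤ F → Sized F (A ∷ Δ) B N → Sized F Δ (A ⊃ B) (suc N)
    ⊃Iˢ C≤F (sized d s) = sized (⊃I d) (one-premise C≤F s)

    ⊃Eˢ : ∀ {A B N₁ N₂} → fsize B ≤ F → Sized F Δ (A ⊃ B) N₁ → Sized F Δ A N₂ →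
          Sized F Δ B (suc (N₁ + N₂))
    ⊃Eˢ B≤F (sized d s) (sized e t) = sized (⊃E d e) (two-premises B≤F s t)

  ⋀-component : ∀ {x : Form At} {xs} → x ∈ xs → fsize x ≤ fsize (⋀ xs)
  ⋀-component {xs = _ ∷ []}     (here refl) = ≤-refl
  ⋀-component {xs = _ ∷ _ ∷ _}  (here refl) = left≤ _ _
  ⋀-component {xs = _ ∷ q ∷ ps} (there x∈) = ≤-trans (⋀-component {xs = q ∷ ps} x∈) (right≤ _ _)

  ⋁-component : ∀ {x : Form At} {xs} → x ∈ xs → fsize x ≤ fsize (⋁ xs)
  ⋁-component {xs = _ ∷ []}     (here refl) = ≤-refl
  ⋁-component {xs = _ ∷ _ ∷ _}  (here refl) = left≤ _ _
  ⋁-component {xs = _ ∷ q ∷ ps} (there x∈) = ≤-trans (⋁-component {xs = q ∷ ps} x∈) (right≤ _ _)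

  ⋀-size : ∀ {m} (xs : List (Form At)) → (∀ x → x ∈ xs → fsize x ≤ m) → fsize (⋀ xs) ≤ length xs * suc m + 3
  ⋀-size []           _  = ≤-refl
  ⋀-size {m} (p ∷ []) xs≤ = ≤-trans (xs≤ p (here refl)) (single≤ m 3)
  ⋀-size {m} (p ∷ q ∷ ps) xs≤ =
    ≤-trans (s≤s (+-mono-≤ (xs≤ p (here refl)) (⋀-size (q ∷ ps) (λ x x∈ → xs≤ x (there x∈)))))
            (≤-reflexive (join-step m (length (q ∷ ps)) 3))

  ⋁-size : ∀ {m} (xs : List (Form At)) → (∀ x → x ∈ xs → fsize x ≤ m) → fsize (⋁ xs) ≤ length xs * suc m + 1
  ⋁-size []           _  = ≤-refl
  ⋁-size {m} (p ∷ []) xs≤ = ≤-trans (xs≤ p (here refl)) (single≤ m 1)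
  ⋁-size {m} (p ∷ q ∷ ps) xs≤ =
    ≤-trans (s≤s (+-mono-≤ (xs≤ p (here refl)) (⋁-size (q ∷ ps) (λ x x∈ → xs≤ x (there x∈)))))
            (≤-reflexive (join-step m (length (q ∷ ps)) 1))

  ⋀-map-size : ∀ {X : Set} {k m} (g : X → Form At) (ys : List X) → length ys ≤ k →
               (∀ y → fsize (g y) ≤ m) → fsize (⋀ (map g ys)) ≤ k * suc m + 3
  ⋀-map-size {m = m} g ys ys≤k g≤ = ≤-trans (⋀-size (map g ys) component≤)
    (+-monoˡ-≤ 3 (*-monoˡ-≤ (suc m) (≤-trans (≤-reflexive (length-map g ys)) ys≤k)))
    where
      component≤ : ∀ x → x ∈ map g ys → fsize x ≤ m
      component≤ x x∈ with ∈-map⁻ g x∈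
      ... | y , _ , refl = g≤ y

  ⋁-map-size : ∀ {X : Set} {m} (g : X → Form At) (ys : List X) →
               (∀ y → fsize (g y) ≤ m) → fsize (⋁ (map g ys)) ≤ length ys * suc m + 1
  ⋁-map-size {m = m} g ys g≤ = subst (λ k → fsize (⋁ (map g ys)) ≤ k * suc m + 1) (length-map g ys)
    (⋁-size (map g ys) component≤)
    where
      component≤ : ∀ x → x ∈ map g ys → fsize x ≤ m
      component≤ x x∈ with ∈-map⁻ g x∈
      ... | y , _ , refl = g≤ y

  -- Derived rules for iterated connectives.  The node counts are linear in the
  -- number of components, which is what keeps the final derivation polynomial.
  module _ {F : ℕ} {Δ : List (Form At)} where

    proj⋀ : ∀ {x xs N} → fsize (⋀ xs) ≤ F → x ∈ xs → Sized F Δ (⋀ xs) N → Sized F Δ x (length xs + N)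
    proj⋀ {xs = _ ∷ []}    _   (here refl) d = weaken (n≤1+n _) d
    proj⋀ {xs = _ ∷ _ ∷ _} ⋀≤F (here refl) d = weaken (s≤s (m≤n+m _ _)) (∧E₁ˢ (≤-trans (left≤ _ _) ⋀≤F) d)
    proj⋀ {xs = _ ∷ q ∷ ps} {N} ⋀≤F (there x∈) d =
      weaken (≤-reflexive (+-suc (length (q ∷ ps)) N))
        (proj⋀ (≤-trans (right≤ _ _) ⋀≤F) x∈ (∧E₂ˢ (≤-trans (right≤ _ _) ⋀≤F) d))

    inj⋁ : ∀ {x xs N} → fsize (⋁ xs) ≤ F → x ∈ xs → Sized F Δ x N → Sized F Δ (⋁ xs) (length xs + N)
    inj⋁ {xs = _ ∷ []}    _   (here refl) d = weaken (n≤1+n _) d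
    inj⋁ {xs = _ ∷ _ ∷ _} ⋁≤F (here refl) d = weaken (s≤s (m≤n+m _ _)) (∨I₁ˢ ⋁≤F d)
    inj⋁ {xs = _ ∷ _ ∷ _} ⋁≤F (there x∈)  d = ∨I₂ˢ ⋁≤F (inj⋁ (≤-trans (right≤ _ _) ⋁≤F) x∈ d)

    build⋀ : ∀ {M} xs → fsize (⋀ xs) ≤ F → (∀ x → x ∈ xs → Sized F Δ x M) →
             Sized F Δ (⋀ xs) (length xs * suc M + 2)
    build⋀ []           ⊤≤F _   = ⊃Iˢ ⊤≤F (hypˢ (≤-trans (s≤s z≤n) ⊤≤F) (here refl))
    build⋀ {M} (p ∷ []) _   all = weaken (single≤ M 2) (all p (here refl))
    build⋀ {M} (p ∷ q ∷ ps) ⋀≤F all =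
      weaken (≤-reflexive (join-step M (length (q ∷ ps)) 2))
        (∧Iˢ ⋀≤F (all p (here refl)) (build⋀ (q ∷ ps) (≤-trans (right≤ _ _) ⋀≤F) (λ x x∈ → all x (there x∈))))

  -- A one-component disjunction is used through
  -- the cut  (x ⊃ C) x,  which is why the size of x ⊃ C must also be at most F.
  cases⋁ : ∀ {F Δ C xs N M} → fsize (⋁ xs) ≤ F → suc (fsize (⋁ xs) + fsize C) ≤ F → Sized F Δ (⋁ xs) N →
           (∀ {Δ'} → Δ ⊆ Δ' → ∀ x → x ∈ xs → x ∈ Δ' → Sized F Δ' C M) →
           Sized F Δ C (N + length xs * (M + 2) + 2)
  cases⋁ {xs = []} {N} {M} _ ⊃≤F d _ =
    weaken (≤-trans (n≤1+n _) (≤-reflexive (nodes N M))) (⊥Eˢ (≤-trans (right≤ _ _) ⊃≤F) d)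
    where
      nodes : ∀ N M → suc (suc N) ≡ N + 0 * (M + 2) + 2
      nodes = solve-∀
  cases⋁ {xs = p ∷ []} {N} {M} _ ⊃≤F d case =
    weaken (≤-trans (m≤m+n _ 2) (≤-reflexive (nodes N M)))
      (⊃Eˢ (≤-trans (right≤ _ _) ⊃≤F) (⊃Iˢ ⊃≤F (case there p (here refl) (here refl))) d)
    where
      nodes : ∀ N M → suc (suc M + N) + 2 ≡ N + 1 * (M + 2) + 2
      nodes = solve-∀
  cases⋁ {C = C} {xs = p ∷ q ∷ ps} {N} {M} ⋁≤F ⊃≤F d case =
    weaken (≤-reflexive (nodes N M (length (q ∷ ps))))
      (∨Eˢ (≤-trans (right≤ _ _) ⊃≤F) d (case there p (here refl) (here refl))
        (cases⋁ {xs = q ∷ ps} (≤-trans (right≤ _ _) ⋁≤F)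
          (≤-trans (s≤s (+-monoˡ-≤ (fsize C) (right≤ _ _))) ⊃≤F)
          (hypˢ (≤-trans (right≤ _ _) ⋁≤F) (here refl))
          (λ Δ⊆ x x∈ x∈Δ' → case (λ y∈ → Δ⊆ (there y∈)) x (there x∈) x∈Δ')))
    where
      nodes : ∀ N M L → suc (N + M + (1 + L * (M + 2) + 2)) ≡ N + suc L * (M + 2) + 2
      nodes = solve-∀

  exclusively : Form At × List (Form At) → Form At
  exclusively (p , rs) = p ∧' ⋀ (map ¬' rs)

  private
    extend-pick : Form At → Form At × List (Form At) → Form At × List (Form At)
    extend-pick q (p , rs) = p , q ∷ rs

  picked∈ : ∀ {p rs} (ps : List (Form At)) → (p , rs) ∈ picks ps → p ∈ ps
  picked∈ (q ∷ ps) (here refl) = here refl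
  picked∈ (q ∷ ps) (there pick∈) with ∈-map⁻ (extend-pick q) pick∈
  ... | _ , pick∈′ , refl = there (picked∈ ps pick∈′)

  rest∈ : ∀ {p rs r} (ps : List (Form At)) → (p , rs) ∈ picks ps → r ∈ rs → r ∈ ps
  rest∈ (q ∷ ps) (here refl) r∈ = there r∈
  rest∈ (q ∷ ps) (there pick∈) r∈ with ∈-map⁻ (extend-pick q) pick∈
  rest∈ (q ∷ ps) (there pick∈) (here refl) | _ , _ , refl = here refl
  rest∈ (q ∷ ps) (there pick∈) (there r∈) | _ , pick∈′ , refl = there (rest∈ ps pick∈′ r∈)

  length-rest : ∀ {p rs} (ps : List (Form At)) → (p , rs) ∈ picks ps → length rs ≤ length ps
  length-rest (q ∷ ps) (here refl) = n≤1+n _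
  length-rest (q ∷ ps) (there pick∈) with ∈-map⁻ (extend-pick q) pick∈
  ... | _ , pick∈′ , refl = s≤s (length-rest ps pick∈′)

  length-picks : ∀ (ps : List (Form At)) → length (picks ps) ≡ length ps
  length-picks []       = refl
  length-picks (q ∷ ps) = cong suc (trans (length-map _ (picks ps)) (length-picks ps))

  ⊕-size : ∀ {m} (ps : List (Form At)) → (∀ x → x ∈ ps → fsize x ≤ m) →
           fsize (⊕ ps) ≤ length ps * suc (suc (m + (length ps * suc (suc (m + 1)) + 3))) + 1
  ⊕-size {m} ps ps≤ =
    subst (λ k → fsize (⊕ ps) ≤ k * suc (suc (m + (length ps * suc (suc (m + 1)) + 3))) + 1)
      (trans (length-map exclusively (picks ps)) (length-picks ps))
      (⋁-size (map exclusively (picks ps)) disjunct≤)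
    where
      disjunct≤ : ∀ y → y ∈ map exclusively (picks ps) → fsize y ≤ suc (m + (length ps * suc (suc (m + 1)) + 3))
      disjunct≤ y y∈ with ∈-map⁻ exclusively y∈
      ... | (p , rs) , pick∈ , refl = s≤s (+-mono-≤ (ps≤ p (picked∈ ps pick∈)) (≤-trans
            (⋀-size (map ¬' rs) negation≤)
            (+-monoˡ-≤ 3 (*-monoˡ-≤ (suc (suc (m + 1)))
              (≤-trans (≤-reflexive (length-map ¬' rs)) (length-rest ps pick∈))))))
        where
          negation≤ : ∀ x → x ∈ map ¬' rs → fsize x ≤ suc (m + 1)
          negation≤ x x∈ with ∈-map⁻ ¬' x∈
          ... | r , r∈ , refl = s≤s (+-monoˡ-≤ 1 (ps≤ r (rest∈ ps pick∈ r∈)))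

  cases⊕ : ∀ {F Δ C ps N M} → fsize (⊕ ps) ≤ F → suc (fsize (⊕ ps) + fsize C) ≤ F → Sized F Δ (⊕ ps) N →
           (∀ {Δ'} → Δ ⊆ Δ' → ∀ p → p ∈ ps → Sized F Δ' p 2 → Sized F Δ' C M) →
           Sized F Δ C (N + length ps * (M + 2) + 2)
  cases⊕ {F} {Δ} {C} {ps} {N} {M} ⊕≤F ⊃≤F d case =
    subst (λ k → Sized F Δ C (N + k * (M + 2) + 2))
      (trans (length-map exclusively (picks ps)) (length-picks ps))
      (cases⋁ ⊕≤F ⊃≤F d disjunct)
    where
      disjunct : ∀ {Δ'} → Δ ⊆ Δ' → ∀ y → y ∈ map exclusively (picks ps) → y ∈ Δ' → Sized F Δ' C M
      disjunct Δ⊆ y y∈ y∈Δ' with ∈-map⁻ exclusively y∈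
      ... | (p , rs) , pick∈ , refl =
        case Δ⊆ p (picked∈ ps pick∈) (∧E₁ˢ (≤-trans (left≤ _ _) y≤F) (hypˢ y≤F y∈Δ'))
        where
          y≤F : fsize y ≤ F
          y≤F = ≤-trans (⋁-component y∈) ⊕≤F

module Construction (M : TM) (f : Machine.Sym M → Machine.Sym M → Machine.Sym M → Machine.Sym M) where
  open TM M
  open Machine M

  sym∈allSym : (a : Sym) → a ∈ allSym
  sym∈allSym (inj₁ x)       = ∈-++⁺ˡ (∈-map⁺ inj₁ (∈-allFin x))
  sym∈allSym (inj₂ (q , x)) =
    ∈-++⁺ʳ (map inj₁ (allFin nΛ)) (∈-map⁺ inj₂ (∈-cartesianProduct⁺ (∈-allFin q) (∈-allFin x)))

  ∈-range : ∀ {a b x} → a ≤ x → x ≤ b → x ∈ range a b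
  ∈-range {a} {b} {x} a≤x x≤b = subst (_∈ range a b) (m+[n∸m]≡n a≤x) (∈-map⁺ (a +_) (∈-upTo⁺ x-a<))
    where
      x-a< : x ∸ a < suc b ∸ a
      x-a< = subst (x ∸ a <_) (sym (+-∸-assoc 1 (≤-trans a≤x x≤b))) (s≤s (∸-monoˡ-≤ a x≤b))

  ∈-range-0⁻ : ∀ {b x} → x ∈ range 0 b → x ≤ b
  ∈-range-0⁻ x∈ with ∈-map⁻ (0 +_) x∈
  ... | _ , y∈ , refl = ≤-pred (∈-upTo⁻ y∈)

  length-range≤ : ∀ a b → length (range a b) ≤ suc b
  length-range≤ a b = ≤-trans
    (≤-reflexive (trans (length-map (a +_) (upTo (suc b ∸ a))) (length-upTo (suc b ∸ a))))
    (m∸n≤m (suc b) a)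

  length-map-range≤ : ∀ {X : Set} (g : ℕ → X) a b → length (map g (range a b)) ≤ suc b
  length-map-range≤ g a b = ≤-trans (≤-reflexive (length-map g (range a b))) (length-range≤ a b)

  K K³ : ℕ
  K  = length allSym
  K³ = length (cartesianProduct allSym (cartesianProduct allSym allSym))

  cellSize tapeSize : SizeExpr
  cellSize = lit (K * 2 + 1)
  tapeSize = 1+ₑ 1+ₑ ℓ̂ *ₑ 1+ₑ cellSize +ₑ lit 3

  conjunctNodes axiomNodes : SizeExpr
  conjunctNodes = 1+ₑ ℓ̂ +ₑ lit 3
  axiomNodes    = lit K³ +ₑ (1+ₑ ℓ̂ +ₑ conjunctNodes)

  cellNodes : SizeExpr
  cellNodes = 1+ₑ 1+ₑ ℓ̂ +ₑ lit 1

  afterSplit : SizeExpr → SizeExpr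
  afterSplit e = cellNodes +ₑ lit K *ₑ (e +ₑ lit 2) +ₑ lit 2

  stepNodes interiorNodes edgeNodes nextCellNodes : SizeExpr
  stepNodes     = lit K +ₑ 1+ₑ (axiomNodes +ₑ lit 5)
  interiorNodes = afterSplit (afterSplit (afterSplit stepNodes))
  edgeNodes     = lit K +ₑ 1+ₑ conjunctNodes
  nextCellNodes = interiorNodes +ₑ edgeNodes

  assembled : SizeExpr → SizeExpr
  assembled e = 1+ₑ 1+ₑ ℓ̂ *ₑ 1+ₑ e +ₑ lit 2

  inputNodes inputCellNodes blankNodes initialCellNodes : SizeExpr
  inputNodes       = 1+ₑ n̂ +ₑ 1+ₑ 1+ₑ conjunctNodes
  inputCellNodes   = inputNodes +ₑ lit (nΣ * (K + 2 + 2)) +ₑ lit 2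
  blankNodes       = lit K +ₑ (1+ₑ ℓ̂ +ₑ 1+ₑ 1+ₑ conjunctNodes)
  initialCellNodes = inputCellNodes +ₑ (blankNodes +ₑ edgeNodes)

  initialTapeNodes nextTapeNodes lastTapeNodes : SizeExpr
  initialTapeNodes = assembled initialCellNodes
  nextTapeNodes    = assembled nextCellNodes
  lastTapeNodes    = initialTapeNodes +ₑ ℓ̂ *ₑ (nextTapeNodes +ₑ lit 2)

  decideNodes sequentNodes : SizeExpr
  decideNodes  = lit K +ₑ lit 5
  sequentNodes = 1+ₑ (1+ₑ afterSplit decideNodes +ₑ lastTapeNodes)

  exactlyOneSize δ₀Size δStepSize δsSize βSize γSize ΓγSize maxSize totalSize : SizeExpr
  exactlyOneSize = lit (nΣ * suc (suc (1 + (nΣ * 4 + 3))) + 1)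
  δ₀Size    = 1+ₑ (exactlyOneSize +ₑ 1+ₑ ((1+ₑ n̂ *ₑ 1+ₑ exactlyOneSize +ₑ lit 3) +ₑ (1+ₑ ℓ̂ *ₑ lit 2 +ₑ lit 3)))
  δStepSize = 1+ₑ ℓ̂ *ₑ 1+ₑ lit (K³ * 8 + 3) +ₑ lit 3
  δsSize    = 1+ₑ ℓ̂ *ₑ 1+ₑ (δ₀Size +ₑ δStepSize) +ₑ lit 3
  βSize     = 1+ₑ ℓ̂ *ₑ lit 4 +ₑ lit 3
  γSize     = lit (K * 4 + 3)
  ΓγSize    = 1+ₑ (1+ₑ (βSize +ₑ δsSize) +ₑ γSize)
  maxSize   = ΓγSize +ₑ tapeSize +ₑ lit 7
  totalSize = 1+ₑ (1+ₑ (maxSize +ₑ maxSize)) *ₑ sequentNodes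

  module Derivation (n ℓ : ℕ) where
    open Encoding f n ℓ

    ⟪_⟫ : SizeExpr → ℕ
    ⟪ e ⟫ = ⟦ e ⟧ n ℓ

    Cell : ℕ → ℕ → Fm
    Cell i t = ⋁ (map (λ a → P a i t) allSym)

    Tape : ℕ → Fm
    Tape t = ⋀ (map (λ i → Cell i t) (range 0 (suc ℓ)))

    Cell-size : ∀ i t → fsize (Cell i t) ≤ ⟪ cellSize ⟫
    Cell-size i t = ⋁-map-size (λ a → P a i t) allSym (λ _ → ≤-refl)

    Tape-size : ∀ t → fsize (Tape t) ≤ ⟪ tapeSize ⟫
    Tape-size t = ⋀-map-size (λ i → Cell i t) (range 0 (suc ℓ)) (length-range≤ 0 (suc ℓ)) (λ i → Cell-size i t)

    -- Every formula in the derivation is a subformula of Γ ∧ γ, a Cell or Tape formula,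
    -- or has size at most 7; every one is of the form A or A ∘ B with A, B of size ≤ Fmax.
    Fmax F : ℕ
    Fmax = fsize (Γ ∧' γ) + ⟪ tapeSize ⟫ + 7
    F    = suc (Fmax + Fmax)

    fits : ∀ {a} → a ≤ Fmax → a ≤ F
    fits a≤ = ≤-trans a≤ (left≤ Fmax Fmax)

    fits₂ : ∀ {a b} → a ≤ Fmax → b ≤ Fmax → suc (a + b) ≤ F
    fits₂ a≤ b≤ = s≤s (+-mono-≤ a≤ b≤)

    ≤Γγ : ∀ {a} → a ≤ fsize (Γ ∧' γ) → a ≤ Fmax
    ≤Γγ a≤ = ≤-trans a≤ (≤-trans (m≤m+n _ ⟪ tapeSize ⟫) (m≤m+n _ 7))

    ≤tape : ∀ {a} → a ≤ ⟪ tapeSize ⟫ → a ≤ Fmax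
    ≤tape a≤ = ≤-trans a≤ (≤-trans (m≤n+m _ (fsize (Γ ∧' γ))) (m≤m+n _ 7))

    ≤7 : ∀ {a} → a ≤ 7 → a ≤ Fmax
    ≤7 a≤ = ≤-trans a≤ (m≤n+m 7 (fsize (Γ ∧' γ) + ⟪ tapeSize ⟫))

    small : ∀ a {_ : T (a ≤ᵇ 7)} → a ≤ F
    small a {a≤7} = fits (≤7 (≤ᵇ⇒≤ a 7 a≤7))

    Tape-fits : ∀ t → fsize (Tape t) ≤ Fmax
    Tape-fits t = ≤tape (Tape-size t)

    Cell-fits : ∀ i t → fsize (Cell i t) ≤ Fmax
    Cell-fits i t = ≤tape (≤-trans (Cell-size i t)
      (≤-trans (n≤1+n _) (≤-trans (m≤n*m _ (suc (suc ℓ))) (m≤m+n _ 3))))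

    infix 2 _⊢[_]_
    _⊢[_]_ : List Fm → ℕ → Fm → Set
    Δ ⊢[ N ] A = Sized F Δ A N

    Γ≤Γγ : fsize Γ ≤ fsize (Γ ∧' γ)
    Γ≤Γγ = left≤ _ _

    γ≤Γγ : fsize γ ≤ fsize (Γ ∧' γ)
    γ≤Γγ = right≤ _ _

    β≤Γγ : fsize β ≤ fsize (Γ ∧' γ)
    β≤Γγ = ≤-trans (left≤ _ _) Γ≤Γγ

    δs≤Γγ : fsize (⋀ (map δ' (range 0 ℓ))) ≤ fsize (Γ ∧' γ)
    δs≤Γγ = ≤-trans (right≤ _ _) Γ≤Γγ

    δ≤Γγ : ∀ {t} → t ≤ ℓ → fsize (δ' t) ≤ fsize (Γ ∧' γ)
    δ≤Γγ t≤ℓ = ≤-trans (⋀-component (∈-map⁺ δ' (∈-range z≤n t≤ℓ))) δs≤Γγ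

    options : (Fin nΣ → Sym) → ℕ → List Fm
    options g i = map (λ a → P (g a) i 0) (allFin nΣ)

    exactlyOne : (Fin nΣ → Sym) → ℕ → Fm
    exactlyOne g i = ⊕ (options g i)

    length-options : ∀ g i → length (options g i) ≡ nΣ
    length-options g i = trans (length-map (λ a → P (g a) i 0) (allFin nΣ)) (length-tabulate {n = nΣ} id)

    inputs blanks : Fm
    inputs = ⋀ (map (λ i → exactlyOne (λ a → inj₁ (ι a)) i) (range 2 n))
    blanks = ⋀ (map (λ i → P (inj₁ B) i 0) (range (suc n) ℓ))

    δ₀≤Γγ : fsize (exactlyOne (λ a → inj₂ (s₀ , ι a)) 1 ∧' inputs ∧' blanks) ≤ fsize (Γ ∧' γ)
    δ₀≤Γγ = δ≤Γγ z≤n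

    start≤Γγ : fsize (exactlyOne (λ a → inj₂ (s₀ , ι a)) 1) ≤ fsize (Γ ∧' γ)
    start≤Γγ = ≤-trans (left≤ _ _) δ₀≤Γγ

    rest≤Γγ : fsize (inputs ∧' blanks) ≤ fsize (Γ ∧' γ)
    rest≤Γγ = ≤-trans (right≤ _ _) δ₀≤Γγ

    inputs≤Γγ : fsize inputs ≤ fsize (Γ ∧' γ)
    inputs≤Γγ = ≤-trans (left≤ _ _) rest≤Γγ

    blanks≤Γγ : fsize blanks ≤ fsize (Γ ∧' γ)
    blanks≤Γγ = ≤-trans (right≤ _ _) rest≤Γγ

    module Assuming {Δ : List Fm} (Γγ∈Δ : Γ ∧' γ ∈ Δ) where

      useΓ : Δ ⊢[ 2 ] Γ
      useΓ = ∧E₁ˢ (fits (≤Γγ Γ≤Γγ)) (hypˢ (fits (≤Γγ ≤-refl)) Γγ∈Δ)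

      useγ : Δ ⊢[ 2 ] γ
      useγ = ∧E₂ˢ (fits (≤Γγ γ≤Γγ)) (hypˢ (fits (≤Γγ ≤-refl)) Γγ∈Δ)

      useδ : ∀ t → t ≤ ℓ → Δ ⊢[ ⟪ conjunctNodes ⟫ ] δ' t
      useδ t t≤ℓ = weaken (+-monoˡ-≤ 3 (length-map-range≤ δ' 0 ℓ))
        (proj⋀ (fits (≤Γγ δs≤Γγ)) (∈-map⁺ δ' (∈-range z≤n t≤ℓ)) (∧E₂ˢ (fits (≤Γγ δs≤Γγ)) useΓ))

      useStart : Δ ⊢[ suc ⟪ conjunctNodes ⟫ ] exactlyOne (λ a → inj₂ (s₀ , ι a)) 1
      useStart = ∧E₁ˢ (fits (≤Γγ start≤Γγ)) (useδ 0 z≤n)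

      useInputs : Δ ⊢[ suc (suc ⟪ conjunctNodes ⟫) ] inputs
      useInputs = ∧E₁ˢ (fits (≤Γγ inputs≤Γγ)) (∧E₂ˢ (fits (≤Γγ rest≤Γγ)) (useδ 0 z≤n))

      useBlanks : Δ ⊢[ suc (suc ⟪ conjunctNodes ⟫) ] blanks
      useBlanks = ∧E₂ˢ (fits (≤Γγ blanks≤Γγ)) (∧E₂ˢ (fits (≤Γγ rest≤Γγ)) (useδ 0 z≤n))

      useβ : ∀ t → t ≤ ℓ → Δ ⊢[ ⟪ conjunctNodes ⟫ ] P (inj₁ B) 0 t ∧' P (inj₁ B) (suc ℓ) t
      useβ t t≤ℓ = weaken (+-monoˡ-≤ 3 (length-map-range≤ _ 0 ℓ))
        (proj⋀ (fits (≤Γγ β≤Γγ)) (∈-map⁺ _ (∈-range z≤n t≤ℓ)) (∧E₁ˢ (fits (≤Γγ β≤Γγ)) useΓ))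

      transition : ∀ t j → suc t ≤ ℓ → suc j ≤ ℓ → ∀ a b c →
        Δ ⊢[ ⟪ axiomNodes ⟫ ] P a j t ∧' P b (suc j) t ∧' P c (suc (suc j)) t ⊃ P (f a b c) (suc j) (suc t)
      transition t j t<ℓ j<ℓ a b c =
        weaken (+-mono-≤ (≤-reflexive (length-map (axiom (suc j)) triples)) (+-monoˡ-≤ _ (length-map-range≤ axioms 1 ℓ)))
          (proj⋀ (≤-trans (⋀-component axioms∈) δ≤F) axiom∈ (proj⋀ δ≤F axioms∈ (useδ (suc t) t<ℓ)))
        where
          axiom : ℕ → Sym × Sym × Sym → Fm
          axiom i (a , b , c) = P a (i ∸ 1) t ∧' P b i t ∧' P c (suc i) t ⊃ P (f a b c) i (suc t)
          axioms : ℕ → Fm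
          axioms i = ⋀ (map (axiom i) triples)
          δ≤F : fsize (δ' (suc t)) ≤ F
          δ≤F = fits (≤Γγ (δ≤Γγ t<ℓ))
          axioms∈ : axioms (suc j) ∈ map axioms (range 1 ℓ)
          axioms∈ = ∈-map⁺ axioms (∈-range (s≤s z≤n) j<ℓ)
          axiom∈ : axiom (suc j) (a , b , c) ∈ map (axiom (suc j)) triples
          axiom∈ = ∈-map⁺ (axiom (suc j)) (∈-cartesianProduct⁺ (sym∈allSym a) (∈-cartesianProduct⁺ (sym∈allSym b) (sym∈allSym c)))

    someSymbol : ∀ {Δ N i t} a → Δ ⊢[ N ] P a i t → Δ ⊢[ K + N ] Cell i t
    someSymbol {Δ} {N} {i} {t} a d = subst (λ k → Δ ⊢[ k + N ] Cell i t) (length-map _ allSym)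
      (inj⋁ (fits (Cell-fits i t)) (∈-map⁺ (λ a → P a i t) (sym∈allSym a)) d)

    cellOf : ∀ {Δ t i} → Tape t ∈ Δ → i ≤ suc ℓ → Δ ⊢[ ⟪ cellNodes ⟫ ] Cell i t
    cellOf {t = t} Tape∈Δ i≤ = weaken (+-monoˡ-≤ 1 (length-map-range≤ _ 0 (suc ℓ)))
      (proj⋀ (fits (Tape-fits t)) (∈-map⁺ (λ i → Cell i t) (∈-range z≤n i≤)) (hypˢ (fits (Tape-fits t)) Tape∈Δ))

    splitCell : ∀ {Δ t i C N} → Tape t ∈ Δ → i ≤ suc ℓ → fsize C ≤ Fmax →
      (∀ {Δ'} → Δ ⊆ Δ' → ∀ a → P a i t ∈ Δ' → Δ' ⊢[ N ] C) → Δ ⊢[ ⟪ cellNodes ⟫ + K * (N + 2) + 2 ] C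
    splitCell {Δ} {t} {i} {C} {N} Tape∈Δ i≤ C≤ case =
      subst (λ k → Δ ⊢[ ⟪ cellNodes ⟫ + k * (N + 2) + 2 ] C) (length-map _ allSym)
        (cases⋁ (fits (Cell-fits i t)) (fits₂ (Cell-fits i t) C≤) (cellOf Tape∈Δ i≤) symbol)
      where
        symbol : ∀ {Δ'} → Δ ⊆ Δ' → ∀ x → x ∈ map (λ a → P a i t) allSym → x ∈ Δ' → Δ' ⊢[ N ] C
        symbol Δ⊆ x x∈ x∈Δ' with ∈-map⁻ _ x∈
        ... | a , _ , refl = case Δ⊆ a x∈Δ'

    transitionStep : ∀ {Δ t j a b c} → Γ ∧' γ ∈ Δ → suc t ≤ ℓ → suc j ≤ ℓ →
           P a j t ∈ Δ → P b (suc j) t ∈ Δ → P c (suc (suc j)) t ∈ Δ → Δ ⊢[ ⟪ stepNodes ⟫ ] Cell (suc j) (suc t)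
    transitionStep {t = t} {j} {a} {b} {c} Γγ∈Δ t<ℓ j<ℓ a∈Δ b∈Δ c∈Δ =
      someSymbol (f a b c)
        (⊃Eˢ (small 1) (Assuming.transition Γγ∈Δ t j t<ℓ j<ℓ a b c)
          (∧Iˢ (small 5) (hypˢ (small 1) a∈Δ) (∧Iˢ (small 3) (hypˢ (small 1) b∈Δ) (hypˢ (small 1) c∈Δ))))

    interiorCell : ∀ {Δ t j} → Γ ∧' γ ∈ Δ → Tape t ∈ Δ → suc t ≤ ℓ → suc j ≤ ℓ →
                   Δ ⊢[ ⟪ interiorNodes ⟫ ] Cell (suc j) (suc t)
    interiorCell {t = t} {j} Γγ∈Δ Tape∈Δ t<ℓ j<ℓ =
      splitCell Tape∈Δ (≤-trans (n≤1+n j) (≤-trans j<ℓ (n≤1+n ℓ))) (Cell-fits (suc j) (suc t)) λ Δ⊆₁ a a∈ →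
      splitCell (Δ⊆₁ Tape∈Δ) (≤-trans j<ℓ (n≤1+n ℓ)) (Cell-fits (suc j) (suc t)) λ Δ⊆₂ b b∈ →
      splitCell (Δ⊆₂ (Δ⊆₁ Tape∈Δ)) (s≤s j<ℓ) (Cell-fits (suc j) (suc t)) λ Δ⊆₃ c c∈ →
      transitionStep (Δ⊆₃ (Δ⊆₂ (Δ⊆₁ Γγ∈Δ))) t<ℓ j<ℓ (Δ⊆₃ (Δ⊆₂ a∈)) (Δ⊆₃ b∈) c∈

    leftEdge : ∀ {Δ t} → Γ ∧' γ ∈ Δ → t ≤ ℓ → Δ ⊢[ ⟪ edgeNodes ⟫ ] Cell 0 t
    leftEdge Γγ∈Δ t≤ℓ = someSymbol (inj₁ B) (∧E₁ˢ (small 1) (Assuming.useβ Γγ∈Δ _ t≤ℓ))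

    rightEdge : ∀ {Δ t} → Γ ∧' γ ∈ Δ → t ≤ ℓ → Δ ⊢[ ⟪ edgeNodes ⟫ ] Cell (suc ℓ) t
    rightEdge Γγ∈Δ t≤ℓ = someSymbol (inj₁ B) (∧E₂ˢ (small 1) (Assuming.useβ Γγ∈Δ _ t≤ℓ))

    nextCell : ∀ {Δ t} → Γ ∧' γ ∈ Δ → Tape t ∈ Δ → suc t ≤ ℓ → ∀ i → i ≤ suc ℓ →
               Δ ⊢[ ⟪ nextCellNodes ⟫ ] Cell i (suc t)
    nextCell Γγ∈Δ _ t<ℓ zero _ = weaken (m≤n+m _ ⟪ interiorNodes ⟫) (leftEdge Γγ∈Δ t<ℓ)
    nextCell Γγ∈Δ Tape∈Δ t<ℓ (suc j) j<ℓ+1 with suc j ≟ suc ℓ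
    ... | yes refl = weaken (m≤n+m _ ⟪ interiorNodes ⟫) (rightEdge Γγ∈Δ t<ℓ)
    ... | no j≢ℓ  = weaken (m≤m+n _ _) (interiorCell Γγ∈Δ Tape∈Δ t<ℓ (≤-pred (≤∧≢⇒< j<ℓ+1 j≢ℓ)))

    assembleTape : ∀ {Δ t N} → (∀ i → i ≤ suc ℓ → Δ ⊢[ N ] Cell i t) → Δ ⊢[ suc (suc ℓ) * suc N + 2 ] Tape t
    assembleTape {Δ} {t} {N} cell = weaken (+-monoˡ-≤ 2 (*-monoˡ-≤ (suc N) (length-map-range≤ _ 0 (suc ℓ))))
      (build⋀ _ (fits (Tape-fits t)) component)
      where
        component : ∀ x → x ∈ map (λ i → Cell i t) (range 0 (suc ℓ)) → Δ ⊢[ N ] x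
        component x x∈ with ∈-map⁻ _ x∈
        ... | i , i∈ , refl = cell i (∈-range-0⁻ i∈)

    fromExactlyOne : ∀ {Δ N i} (g : Fin nΣ → Sym) → fsize (exactlyOne g i) ≤ Fmax →
                     Δ ⊢[ N ] exactlyOne g i → Δ ⊢[ N + nΣ * (K + 2 + 2) + 2 ] Cell i 0
    fromExactlyOne {Δ} {N} {i} g one≤ d =
      subst (λ k → Δ ⊢[ N + k * (K + 2 + 2) + 2 ] Cell i 0) (length-options g i)
        (cases⊕ (fits one≤) (fits₂ one≤ (Cell-fits i 0)) d symbol)
      where
        symbol : ∀ {Δ'} → Δ ⊆ Δ' → ∀ p → p ∈ options g i → Δ' ⊢[ 2 ] p →
                 Δ' ⊢[ K + 2 ] Cell i 0
        symbol _ p p∈ dp with ∈-map⁻ _ p∈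
        ... | a , _ , refl = someSymbol (g a) dp

    startCell : ∀ {Δ} → Γ ∧' γ ∈ Δ → Δ ⊢[ ⟪ inputCellNodes ⟫ ] Cell 1 0
    startCell Γγ∈Δ = fromExactlyOne (λ a → inj₂ (s₀ , ι a)) (≤Γγ start≤Γγ)
      (weaken (≤-trans (n≤1+n _) (m≤n+m _ (suc n))) (Assuming.useStart Γγ∈Δ))

    inputCell : ∀ {Δ i} → Γ ∧' γ ∈ Δ → 2 ≤ i → i ≤ n → Δ ⊢[ ⟪ inputCellNodes ⟫ ] Cell i 0
    inputCell {i = i} Γγ∈Δ 2≤i i≤n = fromExactlyOne (λ a → inj₁ (ι a)) (≤Γγ (≤-trans (⋀-component input∈) inputs≤Γγ))
      (weaken (+-monoˡ-≤ _ (length-map-range≤ _ 2 n)) (proj⋀ (fits (≤Γγ inputs≤Γγ)) input∈ (Assuming.useInputs Γγ∈Δ)))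
      where
        input∈ : exactlyOne (λ a → inj₁ (ι a)) i ∈ map (λ i → exactlyOne (λ a → inj₁ (ι a)) i) (range 2 n)
        input∈ = ∈-map⁺ (λ i → exactlyOne (λ a → inj₁ (ι a)) i) (∈-range 2≤i i≤n)

    blankCell : ∀ {Δ i} → Γ ∧' γ ∈ Δ → suc n ≤ i → i ≤ ℓ → Δ ⊢[ ⟪ blankNodes ⟫ ] Cell i 0
    blankCell Γγ∈Δ n<i i≤ℓ = someSymbol (inj₁ B) (weaken (+-monoˡ-≤ _ (length-map-range≤ _ (suc n) ℓ))
      (proj⋀ (fits (≤Γγ blanks≤Γγ)) (∈-map⁺ (λ i → P (inj₁ B) i 0) (∈-range n<i i≤ℓ)) (Assuming.useBlanks Γγ∈Δ)))

    initialCell : ∀ {Δ} → Γ ∧' γ ∈ Δ → ∀ i → i ≤ suc ℓ → Δ ⊢[ ⟪ initialCellNodes ⟫ ] Cell i 0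
    initialCell Γγ∈Δ zero _ = weaken edge≤ (leftEdge Γγ∈Δ z≤n)
      where edge≤ = ≤-trans (m≤n+m _ ⟪ blankNodes ⟫) (m≤n+m _ ⟪ inputCellNodes ⟫)
    initialCell Γγ∈Δ (suc j) j<ℓ+1 with suc j ≟ suc ℓ
    ... | yes refl = weaken edge≤ (rightEdge Γγ∈Δ z≤n)
      where edge≤ = ≤-trans (m≤n+m _ ⟪ blankNodes ⟫) (m≤n+m _ ⟪ inputCellNodes ⟫)
    initialCell Γγ∈Δ 1 _ | no _ = weaken (m≤m+n _ _) (startCell Γγ∈Δ)
    initialCell Γγ∈Δ (suc (suc k)) j<ℓ+1 | no j≢ℓ with suc (suc k) ≤? n
    ... | yes i≤n = weaken (m≤m+n _ _) (inputCell Γγ∈Δ (s≤s (s≤s z≤n)) i≤n)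
    ... | no i≰n  = weaken (≤-trans (m≤m+n _ ⟪ edgeNodes ⟫) (m≤n+m _ ⟪ inputCellNodes ⟫))
      (blankCell Γγ∈Δ (≰⇒> i≰n) (≤-pred (≤∧≢⇒< j<ℓ+1 j≢ℓ)))

    -- Tape (t+1) is derived under the assumption Tape t and
    -- joined to the derivation of Tape t by a cut  (Tape t ⊃ Tape (t+1)) (Tape t),  so each
    -- step adds a bounded number of nodes: the derivation grows linearly in t.
    tapeAt : ∀ t → t ≤ ℓ → (Γ ∧' γ ∷ []) ⊢[ ⟪ initialTapeNodes ⟫ + t * (⟪ nextTapeNodes ⟫ + 2) ] Tape t
    tapeAt zero _ = weaken (≤-reflexive (sym (+-identityʳ _))) (assembleTape (initialCell (here refl)))
    tapeAt (suc t) t<ℓ = weaken (≤-reflexive (nodes ⟪ initialTapeNodes ⟫ ⟪ nextTapeNodes ⟫ t))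
      (⊃Eˢ (fits (Tape-fits (suc t)))
        (⊃Iˢ (fits₂ (Tape-fits t) (Tape-fits (suc t))) (assembleTape (nextCell (there (here refl)) (here refl) t<ℓ)))
        (tapeAt t (≤-trans (n≤1+n t) t<ℓ)))
      where
        nodes : ∀ a b t → suc (suc b + (a + t * (b + 2))) ≡ a + suc t * (b + 2)
        nodes = solve-∀

    nonFinal : List Sym
    nonFinal = filterᵇ (λ a → not (isFinal a)) allSym

    length-nonFinal : length nonFinal ≤ K
    length-nonFinal = length-filter (T? ∘ (λ a → not (isFinal a))) allSym

    not-final : ∀ a → a ≢ inj₂ (sₐ , B) → a ≢ inj₂ (sᵣ , B) → T (not (isFinal a))
    not-final a a≢sₐ a≢sᵣ rewrite dec-false (a ≟S inj₂ (sₐ , B)) a≢sₐ | dec-false (a ≟S inj₂ (sᵣ , B)) a≢sᵣ = tt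

    refute : ∀ {Δ} a → Γ ∧' γ ∈ Δ → T (not (isFinal a)) → Δ ⊢[ K + 2 ] ¬' (P a 1 ℓ)
    refute a Γγ∈Δ a-not-final =
      weaken (+-monoˡ-≤ 2 (≤-trans (≤-reflexive (length-map _ nonFinal)) length-nonFinal))
        (proj⋀ (fits (≤Γγ γ≤Γγ))
          (∈-map⁺ (λ a → ¬' (P a 1 ℓ)) (∈-filter⁺ (T? ∘ (λ a → not (isFinal a))) (sym∈allSym a) a-not-final))
          (Assuming.useγ Γγ∈Δ))

    decide : ∀ {Δ} a → Γ ∧' γ ∈ Δ → P a 1 ℓ ∈ Δ → Δ ⊢[ ⟪ decideNodes ⟫ ] goal
    decide a Γγ∈Δ a∈Δ with a ≟S inj₂ (sₐ , B)
    ... | yes refl = weaken (≤-trans (≤ᵇ⇒≤ 2 5 _) (m≤n+m 5 K)) (∨I₁ˢ (small 3) (hypˢ (small 1) a∈Δ))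
    ... | no a≢sₐ with a ≟S inj₂ (sᵣ , B)
    ... | yes refl = weaken (≤-trans (≤ᵇ⇒≤ 2 5 _) (m≤n+m 5 K)) (∨I₂ˢ (small 3) (hypˢ (small 1) a∈Δ))
    ... | no a≢sᵣ = weaken (≤-reflexive (nodes K))
      (⊥Eˢ (small 3) (⊃Eˢ (small 1) (refute a Γγ∈Δ (not-final a a≢sₐ a≢sᵣ)) (hypˢ (small 1) a∈Δ)))
      where
        nodes : ∀ k → suc (suc (k + 2 + 1)) ≡ k + 5
        nodes = solve-∀

    sequent : (Γ ∧' γ ∷ []) ⊢[ ⟪ sequentNodes ⟫ ] goal
    sequent = ⊃Eˢ (small 3)
      (⊃Iˢ (fits₂ (Tape-fits ℓ) (≤7 (≤ᵇ⇒≤ 3 7 _)))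
        (splitCell (here refl) (s≤s z≤n) (≤7 (≤ᵇ⇒≤ 3 7 _)) λ Δ⊆ a a∈ → decide a (Δ⊆ (there (here refl))) a∈))
      (tapeAt ℓ ≤-refl)

    exactlyOne-size : ∀ g i → fsize (exactlyOne g i) ≤ ⟪ exactlyOneSize ⟫
    exactlyOne-size g i =
      subst (λ k → fsize (exactlyOne g i) ≤ k * suc (suc (1 + (k * 4 + 3))) + 1) (length-options g i)
        (⊕-size (options g i) atom≤)
      where
        atom≤ : ∀ x → x ∈ options g i → fsize x ≤ 1
        atom≤ x x∈ with ∈-map⁻ _ x∈
        ... | _ , _ , refl = ≤-refl

    δ₀-size : fsize (δ' 0) ≤ ⟪ δ₀Size ⟫
    δ₀-size = s≤s (+-mono-≤ (exactlyOne-size _ 1) (s≤s (+-mono-≤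
      (⋀-map-size _ (range 2 n) (length-range≤ 2 n) (λ i → exactlyOne-size _ i))
      (⋀-map-size _ (range (suc n) ℓ) (length-range≤ (suc n) ℓ) (λ _ → ≤-refl)))))

    δStep-size : ∀ t → fsize (δ' (suc t)) ≤ ⟪ δStepSize ⟫
    δStep-size t = ⋀-map-size _ (range 1 ℓ) (length-range≤ 1 ℓ) (λ _ → ⋀-map-size _ triples ≤-refl (λ _ → ≤-refl))

    δs-size : fsize (⋀ (map δ' (range 0 ℓ))) ≤ ⟪ δsSize ⟫
    δs-size = ⋀-map-size δ' (range 0 ℓ) (length-range≤ 0 ℓ) δ-size
      where
        δ-size : ∀ t → fsize (δ' t) ≤ ⟪ δ₀Size ⟫ + ⟪ δStepSize ⟫
        δ-size zero    = ≤-trans δ₀-size (m≤m+n _ _)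
        δ-size (suc t) = ≤-trans (δStep-size t) (m≤n+m _ ⟪ δ₀Size ⟫)

    Γγ-size : fsize (Γ ∧' γ) ≤ ⟪ ΓγSize ⟫
    Γγ-size = s≤s (+-mono-≤ (s≤s (+-mono-≤ β-size δs-size)) γ-size)
      where
        β-size : fsize β ≤ ⟪ βSize ⟫
        β-size = ⋀-map-size _ (range 0 ℓ) (length-range≤ 0 ℓ) (λ _ → ≤-refl)
        γ-size : fsize γ ≤ ⟪ γSize ⟫
        γ-size = ⋀-map-size _ nonFinal length-nonFinal (λ _ → ≤-refl)

    sequentDerivation : Σ Sequent (λ D → dsize D ≤ ⟪ totalSize ⟫)
    sequentDerivation = derivation sequent , ≤-trans (size-bound sequent) (*-monoˡ-≤ ⟪ sequentNodes ⟫ (s≤s F≤))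
      where
        Fmax≤ : Fmax ≤ ⟪ maxSize ⟫
        Fmax≤ = +-monoˡ-≤ 7 (+-monoˡ-≤ ⟪ tapeSize ⟫ Γγ-size)
        F≤ : F ≤ ⟪ 1+ₑ (maxSize +ₑ maxSize) ⟫
        F≤ = s≤s (+-mono-≤ Fmax≤ Fmax≤)

-- The theorem.
proposition5p3 : (M : TM) (p : Poly) → Machine.NeverLeft M → Machine.HaltsWithin M p →
    (f : Machine.Sym M → Machine.Sym M → Machine.Sym M → Machine.Sym M) → Machine.Describes M f →
    ∃[ c ] ∃[ d ] ((n : ℕ) →
      Σ (Machine.Encoding.Sequent M f n (eval p n)) (λ D → dsize D ≤ c * n ^ d + c))
proposition5p3 M p _ _ f _ =
  let c , d , total≤ = standard-form (⟦⟧-bounded p (Construction.totalSize M f))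
  in c , d , λ n → map₂ (λ D≤ → ≤-trans D≤ (total≤ n))
                        (Construction.Derivation.sequentDerivation M f n (eval p n))
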